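{- For integers $q\geq 0$ and $0\leq n_1\leq n$, and for $x\in\mathbb{C}$, the following polynomial identity in $z$ holds: $$\sum_{k=0}^{n_1}\binom{n}{k}\binom{n+x+q+k-2}{n+q-1}z^{n-k}=\sum_{k=0}^{n_1}\binom{n}{k}\binom{n+x+q-2}{q+n-1-k}\sum_{i=0}^{n_1-k}\binom{n-k}{i}z^{n-k-i}.$$
   Context: For complex $a$ and integer $b$, $\binom{a}{b}=a(a-1)\cdots(a-b+1)/b!$ if $b\geq 0$ and $\binom{a}{b}=0$ if $b<0$. -}

module Defs where

open import Level using (Level)
open import Data.Nat using (ℕ; zero; suc)
open import Data.Integer using (ℤ; +_; -[1+_])
open import Algebra.Bundles using (CommutativeRing)

module _ {c ℓ : Level} (R : CommutativeRing c ℓ) where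
  open CommutativeRing R

  fromℕ : ℕ → Carrier
  fromℕ zero    = 0#
  fromℕ (suc n) = 1# + fromℕ n

  fromℤ : ℤ → Carrier
  fromℤ (+ n)      = fromℕ n
  fromℤ -[1+ n ]   = - fromℕ (suc n)

  pow : Carrier → ℕ → Carrier
  pow z zero    = 1#
  pow z (suc n) = z * pow z n

  -- finite sum  f 0 + f 1 + ... + f m  (inclusive upper bound m)
  sumTo : ℕ → (ℕ → Carrier) → Carrier
  sumTo zero    f = f 0
  sumTo (suc m) f = sumTo m f + f (suc m)

  -- R is a Q-algebra: every positive integer m+1 has inverse  inv m
  IsInverses : (ℕ → Carrier) → Set ℓ
  IsInverses inv = ∀ m → fromℕ (suc m) * inv m ≈ 1#

  falling : Carrier → ℕ → Carrier
  falling a zero    = 1#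
  falling a (suc b) = falling a b * (a - fromℕ b)

  invFact : (ℕ → Carrier) → ℕ → Carrier
  invFact inv zero    = 1#
  invFact inv (suc b) = invFact inv b * inv b

  binom : (ℕ → Carrier) → Carrier → ℤ → Carrier
  binom inv a (+ b)     = falling a b * invFact inv b
  binom inv a -[1+ b ]  = 0#

module Submission where

-- Put M = n + q and a₀ = x + (M - 2).  Since x + (M + k - 2) = a₀ + k, the
-- Chu–Vandermonde identity  binom(a + k, m) = Σ_{j ≤ k} C(k,j) binom(a, m - j),
-- valid for every integer m and proved by induction on k from Pascal's rule,
-- writes each left-hand coefficient binom(a₀ + k, M - 1) in terms of the numbers
-- b_j = binom(a₀, M - 1 - j).  Exchanging the two sums over the triangle
-- j ≤ k ≤ n₁ and using the "subset of a subset" identity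
-- C(n, j+i) C(j+i, j) = C(n, j) C(n-j, i) turns the left side into the right
-- side.

open import Defs
open import Level using (Level)
open import Data.Nat using (ℕ; _∸_; _≤_) renaming (_+_ to _+ℕ_)
open import Data.Nat.Combinatorics using (_C_)
open import Data.Integer using (+_) renaming (_-_ to _-ℤ_)
open import Algebra.Bundles using (CommutativeRing)

open import Data.Nat using (zero; suc; z≤n)
import Data.Nat as ℕ
import Data.Nat.Properties as ℕP
open import Data.Nat.Combinatorics using (k>n⇒nCk≡0; nCk+nC[k+1]≡[n+1]C[k+1])
open import Data.Integer using (ℤ; -[1+_]) renaming (_+_ to _+ℤ_; suc to sucℤ)
import Data.Integer.Properties as ℤP
open import Data.Integer.Tactic.RingSolver using () renaming (solve-∀ to ℤ-solve-∀)
open import Data.Maybe using (nothing)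
open import Relation.Binary.PropositionalEquality as P using (_≡_)
import Relation.Binary.Reasoning.Setoid as SetoidReasoning

module SubsetOfSubset where
  open import Data.Nat
  open import Data.Nat.Properties
  open import Data.Nat.DivMod using (m/n*n≡m)
  open import Data.Nat.Combinatorics using (nCk≡n!/k![n-k]!; k![n∸k]!∣n!)
  open import Data.Nat.Tactic.RingSolver using (solve-∀)
  open import Relation.Binary.PropositionalEquality
  open import Relation.Nullary using (yes; no)
  open ≡-Reasoning

  choose-factorials : ∀ {n k} → k ≤ n → (n C k) * (k ! * (n ∸ k) !) ≡ n !
  choose-factorials {n} {k} k≤n =
    trans (cong (_* (k ! * (n ∸ k) !)) (nCk≡n!/k![n-k]! k≤n))
          (m/n*n≡m {{k !* (n ∸ k) !≢0}} (k![n∸k]!∣n! k≤n))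

  -- Choosing j+i elements of n and then j of those is choosing j elements of n
  -- and then i of the remaining n-j.  For j+i ≤ n both sides times
  -- j!·i!·(n-j-i)! equal n!; otherwise both sides vanish.
  choose-choose : ∀ n j i → (n C (j + i)) * ((j + i) C j) ≡ (n C j) * ((n ∸ j) C i)
  choose-choose n j i with j + i ≤? n
  ... | yes j+i≤n = *-cancelʳ-≡ _ _ D {{D≢0}} (trans (lhs·D≡n!) (sym rhs·D≡n!))
    where
    D : ℕ
    D = j ! * i ! * (n ∸ (j + i)) !
    D≢0 : NonZero D
    D≢0 = m*n≢0 (j ! * i !) _ {{j !* i !≢0}} {{(n ∸ (j + i)) !≢0}}
    lhs·D≡n! : (n C (j + i)) * ((j + i) C j) * D ≡ n !
    lhs·D≡n! = begin
      (n C (j + i)) * ((j + i) C j) * D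
        ≡⟨ regroup (n C (j + i)) ((j + i) C j) (j !) (i !) ((n ∸ (j + i)) !) ⟩
      (n C (j + i)) * (((j + i) C j) * (j ! * i !) * (n ∸ (j + i)) !)
        ≡⟨ cong (λ t → (n C (j + i)) * (((j + i) C j) * (j ! * t !) * (n ∸ (j + i)) !))
                (sym (m+n∸m≡n j i)) ⟩
      (n C (j + i)) * (((j + i) C j) * (j ! * (j + i ∸ j) !) * (n ∸ (j + i)) !)
        ≡⟨ cong (λ t → (n C (j + i)) * (t * (n ∸ (j + i)) !)) (choose-factorials (m≤m+n j i)) ⟩
      (n C (j + i)) * ((j + i) ! * (n ∸ (j + i)) !)
        ≡⟨ choose-factorials j+i≤n ⟩
      n ! ∎
      where
      regroup : ∀ X Y a b d → X * Y * (a * b * d) ≡ X * (Y * (a * b) * d)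
      regroup = solve-∀
    rhs·D≡n! : (n C j) * ((n ∸ j) C i) * D ≡ n !
    rhs·D≡n! = begin
      (n C j) * ((n ∸ j) C i) * D
        ≡⟨ regroup (n C j) ((n ∸ j) C i) (j !) (i !) ((n ∸ (j + i)) !) ⟩
      (n C j) * (j ! * (((n ∸ j) C i) * (i ! * (n ∸ (j + i)) !)))
        ≡⟨ cong (λ t → (n C j) * (j ! * (((n ∸ j) C i) * (i ! * t !)))) (sym (∸-+-assoc n j i)) ⟩
      (n C j) * (j ! * (((n ∸ j) C i) * (i ! * (n ∸ j ∸ i) !)))
        ≡⟨ cong (λ t → (n C j) * (j ! * t)) (choose-factorials i≤n∸j) ⟩
      (n C j) * (j ! * (n ∸ j) !)
        ≡⟨ choose-factorials (≤-trans (m≤m+n j i) j+i≤n) ⟩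
      n ! ∎
      where
      regroup : ∀ X Y a b d → X * Y * (a * b * d) ≡ X * (a * (Y * (b * d)))
      regroup = solve-∀
      i≤n∸j : i ≤ n ∸ j
      i≤n∸j = subst (_≤ n ∸ j) (m+n∸m≡n j i) (∸-monoˡ-≤ j j+i≤n)
  ... | no j+i≰n with j ≤? n
  ...   | no j≰n = begin
      (n C (j + i)) * ((j + i) C j) ≡⟨ cong (_* ((j + i) C j)) (k>n⇒nCk≡0 (≰⇒> j+i≰n)) ⟩
      0                             ≡⟨ cong (_* ((n ∸ j) C i)) (k>n⇒nCk≡0 (≰⇒> j≰n)) ⟨
      (n C j) * ((n ∸ j) C i) ∎
  ...   | yes j≤n = begin
      (n C (j + i)) * ((j + i) C j) ≡⟨ cong (_* ((j + i) C j)) (k>n⇒nCk≡0 (≰⇒> j+i≰n)) ⟩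
      0                             ≡⟨ *-zeroʳ (n C j) ⟨
      (n C j) * 0                   ≡⟨ cong ((n C j) *_) (k>n⇒nCk≡0 i>n∸j) ⟨
      (n C j) * ((n ∸ j) C i) ∎
    where
    i>n∸j : i > n ∸ j
    i>n∸j = ≰⇒> λ i≤n∸j → j+i≰n (subst (j + i ≤_) (m+[n∸m]≡n j≤n) (+-monoʳ-≤ j i≤n∸j))

open SubsetOfSubset using (choose-choose)

sub-then-sub-one : ∀ (m J : ℤ) → (m -ℤ J) -ℤ + 1 ≡ m -ℤ (+ 1 +ℤ J)
sub-then-sub-one = ℤ-solve-∀

sub-one-then-sub : ∀ (m J : ℤ) → (m -ℤ + 1) -ℤ J ≡ m -ℤ (+ 1 +ℤ J)
sub-one-then-sub = ℤ-solve-∀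

add-then-sub : ∀ (A K D : ℤ) → (A +ℤ K) -ℤ D ≡ K +ℤ (A -ℤ D)
add-then-sub = ℤ-solve-∀

module _ {c ℓ : Level} (R : CommutativeRing c ℓ) where
  open CommutativeRing R
  open SetoidReasoning setoid
  open import Algebra.Properties.AbelianGroup +-abelianGroup using (⁻¹-∙-comm; ε⁻¹≈ε)
  open import Algebra.Solver.Ring.NaturalCoefficients commutativeSemiring (λ _ _ → nothing)
    using (solve; _:=_; _:+_; _:*_)

  private
    nat : ℕ → Carrier
    nat = fromℕ R
    int : ℤ → Carrier
    int = fromℤ R
    ∑ : ℕ → (ℕ → Carrier) → Carrier
    ∑ = sumTo R

  fromℕ-+ : ∀ m n → nat (m +ℕ n) ≈ nat m + nat n
  fromℕ-+ zero    n = sym (+-identityˡ _)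
  fromℕ-+ (suc m) n = trans (+-congˡ (fromℕ-+ m n)) (sym (+-assoc _ _ _))

  fromℕ-* : ∀ m n → nat (m ℕ.* n) ≈ nat m * nat n
  fromℕ-* zero    n = sym (zeroˡ _)
  fromℕ-* (suc m) n = begin
    nat (n +ℕ m ℕ.* n)      ≈⟨ fromℕ-+ n (m ℕ.* n) ⟩
    nat n + nat (m ℕ.* n)   ≈⟨ +-cong (sym (*-identityˡ _)) (fromℕ-* m n) ⟩
    1# * nat n + nat m * nat n ≈⟨ distribʳ _ _ _ ⟨
    (1# + nat m) * nat n ∎

  negate-succ-plus-one : ∀ y → - (1# + y) + 1# ≈ - y
  negate-succ-plus-one y = begin
    - (1# + y) + 1#       ≈⟨ +-congʳ (⁻¹-∙-comm 1# y) ⟨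
    (- 1# + - y) + 1#     ≈⟨ solve 3 (λ m1 my o → (m1 :+ my) :+ o := my :+ (o :+ m1)) refl (- 1#) (- y) 1# ⟩
    - y + (1# + - 1#)     ≈⟨ +-congˡ (-‿inverseʳ 1#) ⟩
    - y + 0#              ≈⟨ +-identityʳ _ ⟩
    - y ∎

  fromℤ-suc : ∀ i → int (sucℤ i) ≈ int i + 1#
  fromℤ-suc (+ n)            = +-comm 1# (nat n)
  fromℤ-suc -[1+ zero ]      = sym (trans (negate-succ-plus-one 0#) ε⁻¹≈ε)
  fromℤ-suc -[1+ suc n ]     = sym (negate-succ-plus-one (1# + nat n))

  fromℤ-+ℕ : ∀ k i → int (+ k +ℤ i) ≈ int i + nat k
  fromℤ-+ℕ zero    i = trans (reflexive (P.cong int (ℤP.+-identityˡ i))) (sym (+-identityʳ _))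
  fromℤ-+ℕ (suc k) i = begin
    int (+ suc k +ℤ i)       ≈⟨ reflexive (P.cong int (ℤP.suc-+ k i)) ⟩
    int (sucℤ (+ k +ℤ i))    ≈⟨ fromℤ-suc (+ k +ℤ i) ⟩
    int (+ k +ℤ i) + 1#      ≈⟨ +-congʳ (fromℤ-+ℕ k i) ⟩
    (int i + nat k) + 1#     ≈⟨ +-assoc _ _ _ ⟩
    int i + (nat k + 1#)     ≈⟨ +-congˡ (+-comm _ _) ⟩
    int i + (1# + nat k) ∎

  shift-by-nat : ∀ x M k d → x + int (+ (M +ℕ k) -ℤ d) ≈ (x + int (+ M -ℤ d)) + nat k
  shift-by-nat x M k d = begin
    x + int (+ (M +ℕ k) -ℤ d)     ≈⟨ +-congˡ (reflexive (P.cong int index)) ⟩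
    x + int (+ k +ℤ (+ M -ℤ d))   ≈⟨ +-congˡ (fromℤ-+ℕ k (+ M -ℤ d)) ⟩
    x + (int (+ M -ℤ d) + nat k)  ≈⟨ +-assoc _ _ _ ⟨
    (x + int (+ M -ℤ d)) + nat k ∎
    where
    index : + (M +ℕ k) -ℤ d ≡ + k +ℤ (+ M -ℤ d)
    index = P.trans (P.cong (_-ℤ d) (ℤP.pos-+ M k)) (add-then-sub (+ M) (+ k) d)

  ∑-cong : ∀ N {f g : ℕ → Carrier} → (∀ k → k ≤ N → f k ≈ g k) → ∑ N f ≈ ∑ N g
  ∑-cong zero    f≈g = f≈g 0 z≤n
  ∑-cong (suc N) f≈g = +-cong (∑-cong N (λ k k≤N → f≈g k (ℕP.m≤n⇒m≤1+n k≤N))) (f≈g (suc N) ℕP.≤-refl)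

  ∑-congᵖ : ∀ N {f g : ℕ → Carrier} → (∀ k → f k ≈ g k) → ∑ N f ≈ ∑ N g
  ∑-congᵖ N f≈g = ∑-cong N (λ k _ → f≈g k)

  ∑-bound : ∀ {M M'} (f : ℕ → Carrier) → M ≡ M' → ∑ M f ≈ ∑ M' f
  ∑-bound f M≡M' = reflexive (P.cong (λ t → ∑ t f) M≡M')

  ∑-+ : ∀ N (f g : ℕ → Carrier) → ∑ N (λ k → f k + g k) ≈ ∑ N f + ∑ N g
  ∑-+ zero    f g = refl
  ∑-+ (suc N) f g = trans (+-congʳ (∑-+ N f g))
    (solve 4 (λ a b d e → (a :+ b) :+ (d :+ e) := (a :+ d) :+ (b :+ e)) refl _ _ _ _)

  ∑-*ˡ : ∀ N d (f : ℕ → Carrier) → d * ∑ N f ≈ ∑ N (λ k → d * f k)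
  ∑-*ˡ zero    d f = refl
  ∑-*ˡ (suc N) d f = trans (distribˡ _ _ _) (+-congʳ (∑-*ˡ N d f))

  ∑-*ʳ : ∀ N d (f : ℕ → Carrier) → ∑ N f * d ≈ ∑ N (λ k → f k * d)
  ∑-*ʳ zero    d f = refl
  ∑-*ʳ (suc N) d f = trans (distribʳ _ _ _) (+-congʳ (∑-*ʳ N d f))

  ∑-first : ∀ N (f : ℕ → Carrier) → ∑ (suc N) f ≈ f 0 + ∑ N (λ k → f (suc k))
  ∑-first zero    f = refl
  ∑-first (suc N) f = trans (+-congʳ (∑-first N f)) (+-assoc _ _ _)

  ∑-triangle : ∀ N (F : ℕ → ℕ → Carrier) →
    ∑ N (λ k → ∑ k (F k)) ≈ ∑ N (λ j → ∑ (N ∸ j) (λ i → F (j +ℕ i) j))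
  ∑-triangle zero    F = refl
  ∑-triangle (suc N) F = begin
    ∑ N (λ k → ∑ k (F k)) + (∑ N (F (suc N)) + F (suc N) (suc N))
      ≈⟨ +-congʳ (∑-triangle N F) ⟩
    ∑ N columns + (∑ N (F (suc N)) + F (suc N) (suc N))
      ≈⟨ +-assoc _ _ _ ⟨
    (∑ N columns + ∑ N (F (suc N))) + F (suc N) (suc N)
      ≈⟨ +-cong (∑-+ N columns (F (suc N))) last-column ⟨
    ∑ N (λ j → columns j + F (suc N) j) + columns′ (suc N)
      ≈⟨ +-congʳ (∑-cong N extend-column) ⟩
    ∑ N columns′ + columns′ (suc N) ∎
    where
    columns columns′ : ℕ → Carrier
    columns  j = ∑ (N ∸ j)     (λ i → F (j +ℕ i) j)
    columns′ j = ∑ (suc N ∸ j) (λ i → F (j +ℕ i) j)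
    last-column : columns′ (suc N) ≈ F (suc N) (suc N)
    last-column = trans (∑-bound (λ i → F (suc N +ℕ i) (suc N)) (ℕP.n∸n≡0 N))
                        (reflexive (P.cong (λ t → F t (suc N)) (ℕP.+-identityʳ (suc N))))
    extend-column : ∀ j → j ≤ N → columns j + F (suc N) j ≈ columns′ j
    extend-column j j≤N = sym (trans (∑-bound (λ i → F (j +ℕ i) j) (ℕP.+-∸-assoc 1 j≤N))
      (+-congˡ (reflexive (P.cong (λ t → F t j)
        (P.trans (ℕP.+-suc j (N ∸ j)) (P.cong suc (ℕP.m+[n∸m]≡n j≤N)))))))

  ∑-pascal : ∀ k (g : ℕ → Carrier) →
    ∑ k (λ j → nat (k C j) * g j) + ∑ k (λ j → nat (k C j) * g (suc j))
    ≈ ∑ (suc k) (λ j → nat (suc k C j) * g j)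
  ∑-pascal k g = begin
    ∑ k f + shifted                  ≈⟨ +-congʳ f-split ⟩
    (f 0 + ∑ k next) + shifted       ≈⟨ solve 3 (λ a b d → (a :+ b) :+ d := a :+ (d :+ b)) refl _ _ _ ⟩
    f 0 + (shifted + ∑ k next)       ≈⟨ +-congˡ (trans (∑-congᵖ k pascal-term) (∑-+ k _ _)) ⟨
    f 0 + ∑ k (λ j → nat (suc k C suc j) * g (suc j)) ≈⟨ ∑-first k (λ j → nat (suc k C j) * g j) ⟨
    ∑ (suc k) (λ j → nat (suc k C j) * g j) ∎
    where
    f next : ℕ → Carrier
    f    j = nat (k C j) * g j
    next j = nat (k C suc j) * g (suc j)
    shifted : Carrier
    shifted = ∑ k (λ j → nat (k C j) * g (suc j))
    f-vanishes : f (suc k) ≈ 0#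
    f-vanishes = trans (*-congʳ (reflexive (P.cong nat (k>n⇒nCk≡0 (ℕP.n<1+n k))))) (zeroˡ _)
    f-split : ∑ k f ≈ f 0 + ∑ k next
    f-split = trans (sym (trans (+-congˡ f-vanishes) (+-identityʳ _))) (∑-first k f)
    pascal-term : ∀ j → nat (suc k C suc j) * g (suc j) ≈ nat (k C j) * g (suc j) + next j
    pascal-term j = trans (*-congʳ (trans (reflexive (P.cong nat (P.sym (nCk+nC[k+1]≡[n+1]C[k+1] k j))))
                                          (fromℕ-+ (k C j) (k C suc j))))
                          (distribʳ _ _ _)

  binomial-exchange : ∀ n N (b : ℕ → Carrier) (z : Carrier) →
    ∑ N (λ k → nat (n C k) * ∑ k (λ j → nat (k C j) * b j) * pow R z (n ∸ k))
    ≈ ∑ N (λ j → nat (n C j) * b j * ∑ (N ∸ j) (λ i → nat ((n ∸ j) C i) * pow R z (n ∸ j ∸ i)))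
  binomial-exchange n N b z = begin
    ∑ N (λ k → nat (n C k) * ∑ k (λ j → nat (k C j) * b j) * pow R z (n ∸ k))
      ≈⟨ ∑-congᵖ N expand ⟩
    ∑ N (λ k → ∑ k (F k))
      ≈⟨ ∑-triangle N F ⟩
    ∑ N (λ j → ∑ (N ∸ j) (λ i → F (j +ℕ i) j))
      ≈⟨ ∑-congᵖ N factor ⟩
    ∑ N (λ j → nat (n C j) * b j * ∑ (N ∸ j) (λ i → nat ((n ∸ j) C i) * pow R z (n ∸ j ∸ i))) ∎
    where
    F : ℕ → ℕ → Carrier
    F k j = nat (n C k) * (nat (k C j) * b j) * pow R z (n ∸ k)
    expand : ∀ k → nat (n C k) * ∑ k (λ j → nat (k C j) * b j) * pow R z (n ∸ k) ≈ ∑ k (F k)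
    expand k = trans (*-congʳ (∑-*ˡ k _ _)) (∑-*ʳ k _ _)
    term : ∀ j i → F (j +ℕ i) j ≈ (nat (n C j) * b j) * (nat ((n ∸ j) C i) * pow R z (n ∸ j ∸ i))
    term j i = begin
      nat (n C (j +ℕ i)) * (nat ((j +ℕ i) C j) * b j) * pow R z (n ∸ (j +ℕ i))
        ≈⟨ solve 4 (λ A B d e → A :* (B :* d) :* e := (A :* B) :* d :* e) refl _ _ _ _ ⟩
      nat (n C (j +ℕ i)) * nat ((j +ℕ i) C j) * b j * pow R z (n ∸ (j +ℕ i))
        ≈⟨ *-cong (*-congʳ coefficients) (reflexive (P.cong (pow R z) (P.sym (ℕP.∸-+-assoc n j i)))) ⟩
      nat (n C j) * nat ((n ∸ j) C i) * b j * pow R z (n ∸ j ∸ i)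
        ≈⟨ solve 4 (λ A B d e → (A :* B) :* d :* e := (A :* d) :* (B :* e)) refl _ _ _ _ ⟩
      (nat (n C j) * b j) * (nat ((n ∸ j) C i) * pow R z (n ∸ j ∸ i)) ∎
      where
      coefficients : nat (n C (j +ℕ i)) * nat ((j +ℕ i) C j) ≈ nat (n C j) * nat ((n ∸ j) C i)
      coefficients = begin
        nat (n C (j +ℕ i)) * nat ((j +ℕ i) C j) ≈⟨ fromℕ-* (n C (j +ℕ i)) ((j +ℕ i) C j) ⟨
        nat ((n C (j +ℕ i)) ℕ.* ((j +ℕ i) C j)) ≈⟨ reflexive (P.cong nat (choose-choose n j i)) ⟩
        nat ((n C j) ℕ.* ((n ∸ j) C i))          ≈⟨ fromℕ-* (n C j) ((n ∸ j) C i) ⟩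
        nat (n C j) * nat ((n ∸ j) C i) ∎
    factor : ∀ j → ∑ (N ∸ j) (λ i → F (j +ℕ i) j)
               ≈ nat (n C j) * b j * ∑ (N ∸ j) (λ i → nat ((n ∸ j) C i) * pow R z (n ∸ j ∸ i))
    factor j = trans (∑-congᵖ (N ∸ j) (term j)) (sym (∑-*ˡ (N ∸ j) _ _))

  falling-cong : ∀ {a a'} → a ≈ a' → ∀ b → falling R a b ≈ falling R a' b
  falling-cong a≈a' zero    = refl
  falling-cong a≈a' (suc b) = *-cong (falling-cong a≈a' b) (+-congʳ a≈a')

  falling-succ : ∀ a b → falling R (a + 1#) (suc b) ≈ (a + 1#) * falling R a b
  falling-succ a zero = begin
    1# * ((a + 1#) - 0#) ≈⟨ *-identityˡ _ ⟩
    (a + 1#) - 0#        ≈⟨ +-congˡ ε⁻¹≈ε ⟩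
    (a + 1#) + 0#        ≈⟨ +-identityʳ _ ⟩
    a + 1#               ≈⟨ *-identityʳ _ ⟨
    (a + 1#) * 1# ∎
  falling-succ a (suc b) = begin
    falling R (a + 1#) (suc b) * ((a + 1#) - (1# + nat b))
      ≈⟨ *-cong (falling-succ a b) last-factor ⟩
    ((a + 1#) * falling R a b) * (a - nat b)
      ≈⟨ *-assoc _ _ _ ⟩
    (a + 1#) * falling R a (suc b) ∎
    where
    last-factor : (a + 1#) - (1# + nat b) ≈ a - nat b
    last-factor = begin
      (a + 1#) + - (1# + nat b)   ≈⟨ +-congˡ (⁻¹-∙-comm 1# (nat b)) ⟨
      (a + 1#) + (- 1# + - nat b) ≈⟨ solve 4 (λ a o m1 mB → (a :+ o) :+ (m1 :+ mB) := (a :+ mB) :+ (o :+ m1))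
                                             refl a 1# (- 1#) (- nat b) ⟩
      (a - nat b) + (1# - 1#)     ≈⟨ +-congˡ (-‿inverseʳ 1#) ⟩
      (a - nat b) + 0#            ≈⟨ +-identityʳ _ ⟩
      a - nat b ∎

  module _ (inv : ℕ → Carrier) (isInv : IsInverses R inv) where
    private
      binomial : Carrier → ℤ → Carrier
      binomial = binom R inv

    binom-cong : ∀ {a a'} → a ≈ a' → ∀ t → binomial a t ≈ binomial a' t
    binom-cong a≈a' (+ b)    = *-congʳ (falling-cong a≈a' b)
    binom-cong a≈a' -[1+ b ] = refl

    pascal-succ : ∀ a b → binomial (a + 1#) (+ suc b) ≈ binomial a (+ suc b) + binomial a (+ b)
    pascal-succ a b = sym (begin
      (F * (a - B)) * (I * v) + F * I
        ≈⟨ +-congˡ (trans (sym (*-identityʳ _)) (*-congˡ (sym (isInv b)))) ⟩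
      (F * (a - B)) * (I * v) + (F * I) * ((1# + B) * v)
        ≈⟨ solve 7 (λ F I v a mB o B → (F :* (a :+ mB)) :* (I :* v) :+ (F :* I) :* ((o :+ B) :* v)
                                       := (F :* (I :* v)) :* ((a :+ mB) :+ (o :+ B))) refl F I v a (- B) 1# B ⟩
      (F * (I * v)) * ((a - B) + (1# + B))
        ≈⟨ *-congˡ cancel-B ⟩
      (F * (I * v)) * (a + 1#)
        ≈⟨ solve 4 (λ F I v a1 → (F :* (I :* v)) :* a1 := (a1 :* F) :* (I :* v)) refl F I v (a + 1#) ⟩
      ((a + 1#) * F) * (I * v)
        ≈⟨ *-congʳ (falling-succ a b) ⟨
      falling R (a + 1#) (suc b) * (I * v) ∎)
      where
      F I v B : Carrier
      F = falling R a b
      I = invFact R inv b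
      v = inv b
      B = nat b
      cancel-B : (a - B) + (1# + B) ≈ a + 1#
      cancel-B = begin
        (a - B) + (1# + B)   ≈⟨ solve 4 (λ a o B mB → (a :+ mB) :+ (o :+ B) := (a :+ o) :+ (B :+ mB))
                                       refl a 1# B (- B) ⟩
        (a + 1#) + (B - B)   ≈⟨ +-congˡ (-‿inverseʳ B) ⟩
        (a + 1#) + 0#        ≈⟨ +-identityʳ _ ⟩
        a + 1# ∎

    pascal : ∀ a t → binomial (a + 1#) t ≈ binomial a t + binomial a (t -ℤ + 1)
    pascal a (+ zero)  = sym (+-identityʳ _)
    pascal a (+ suc b) = pascal-succ a b
    pascal a -[1+ b ]  = sym (+-identityʳ _)

    vandermonde : ∀ k a (m : ℤ) → binomial (a + nat k) m ≈ ∑ k (λ j → nat (k C j) * binomial a (m -ℤ + j))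
    vandermonde zero a m = begin
      binomial (a + 0#) m              ≈⟨ binom-cong (+-identityʳ a) m ⟩
      binomial a m                     ≈⟨ reflexive (P.cong (binomial a) (P.sym (ℤP.+-identityʳ m))) ⟩
      binomial a (m -ℤ + 0)            ≈⟨ trans (*-congʳ (+-identityʳ 1#)) (*-identityˡ _) ⟨
      (1# + 0#) * binomial a (m -ℤ + 0) ∎
    vandermonde (suc k) a m = begin
      binomial (a + (1# + nat k)) m
        ≈⟨ binom-cong (sym (+-assoc _ _ _)) m ⟩
      binomial ((a + 1#) + nat k) m
        ≈⟨ vandermonde k (a + 1#) m ⟩
      ∑ k (λ j → nat (k C j) * binomial (a + 1#) (m -ℤ + j))
        ≈⟨ ∑-congᵖ k (λ j → trans (*-congˡ (pascal a (m -ℤ + j))) (distribˡ _ _ _)) ⟩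
      ∑ k (λ j → nat (k C j) * b j + nat (k C j) * binomial a ((m -ℤ + j) -ℤ + 1))
        ≈⟨ ∑-+ k _ _ ⟩
      ∑ k (λ j → nat (k C j) * b j) + ∑ k (λ j → nat (k C j) * binomial a ((m -ℤ + j) -ℤ + 1))
        ≈⟨ +-congˡ (∑-congᵖ k (λ j → *-congˡ (reflexive (P.cong (binomial a) (sub-then-sub-one m (+ j)))))) ⟩
      ∑ k (λ j → nat (k C j) * b j) + ∑ k (λ j → nat (k C j) * b (suc j))
        ≈⟨ ∑-pascal k b ⟩
      ∑ (suc k) (λ j → nat (suc k C j) * b j) ∎
      where
      b : ℕ → Carrier
      b j = binomial a (m -ℤ + j)

theorem3p1 : {c ℓ : Level} (R : CommutativeRing c ℓ) (inv : ℕ → CommutativeRing.Carrier R) →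
    IsInverses R inv →
    (q n n₁ : ℕ) → n₁ ≤ n → (x z : CommutativeRing.Carrier R) →
    let open CommutativeRing R in
    sumTo R n₁ (λ k → fromℕ R (n C k)
        * binom R inv (x + fromℤ R ((+ (n +ℕ q +ℕ k)) -ℤ (+ 2))) ((+ (n +ℕ q)) -ℤ (+ 1))
        * pow R z (n ∸ k))
    ≈ sumTo R n₁ (λ k → fromℕ R (n C k)
        * binom R inv (x + fromℤ R ((+ (n +ℕ q)) -ℤ (+ 2))) ((+ (q +ℕ n)) -ℤ (+ (1 +ℕ k)))
        * sumTo R (n₁ ∸ k) (λ i → fromℕ R ((n ∸ k) C i) * pow R z (n ∸ k ∸ i)))
theorem3p1 R inv isInv q n n₁ _ x z = begin
  sumTo R n₁ (λ k → fromℕ R (n C k) * binom R inv (x + fromℤ R (+ (n +ℕ q +ℕ k) -ℤ + 2)) m * pow R z (n ∸ k))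
    ≈⟨ ∑-congᵖ R n₁ (λ k → *-congʳ (*-congˡ (expand k))) ⟩
  sumTo R n₁ (λ k → fromℕ R (n C k) * sumTo R k (λ j → fromℕ R (k C j) * b j) * pow R z (n ∸ k))
    ≈⟨ binomial-exchange R n n₁ b z ⟩
  sumTo R n₁ (λ j → fromℕ R (n C j) * b j * sumTo R (n₁ ∸ j) (λ i → fromℕ R ((n ∸ j) C i) * pow R z (n ∸ j ∸ i)))
    ≈⟨ ∑-congᵖ R n₁ (λ j → *-congʳ (*-congˡ (reflexive (P.cong (binom R inv a₀) (lower-index j))))) ⟩
  sumTo R n₁ (λ j → fromℕ R (n C j) * binom R inv a₀ (+ (q +ℕ n) -ℤ + (1 +ℕ j))
                    * sumTo R (n₁ ∸ j) (λ i → fromℕ R ((n ∸ j) C i) * pow R z (n ∸ j ∸ i))) ∎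
  where
  open CommutativeRing R
  open SetoidReasoning setoid
  a₀ : Carrier
  a₀ = x + fromℤ R (+ (n +ℕ q) -ℤ + 2)
  m : ℤ
  m = + (n +ℕ q) -ℤ + 1
  b : ℕ → Carrier
  b j = binom R inv a₀ (m -ℤ + j)
  expand : ∀ k → binom R inv (x + fromℤ R (+ (n +ℕ q +ℕ k) -ℤ + 2)) m ≈ sumTo R k (λ j → fromℕ R (k C j) * b j)
  expand k = trans (binom-cong R inv isInv (shift-by-nat R x (n +ℕ q) k (+ 2)) m) (vandermonde R inv isInv k a₀ m)
  lower-index : ∀ j → m -ℤ + j ≡ + (q +ℕ n) -ℤ + (1 +ℕ j)
  lower-index j = P.trans (sub-one-then-sub (+ (n +ℕ q)) (+ j)) (P.cong (λ t → + t -ℤ + (1 +ℕ j)) (ℕP.+-comm n q))
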